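{- Let $n=2^em$ with $e\in\{0,1\}$ and $m$ an odd square-free positive integer. (1) If $n$ is odd, every class in $J^*_{\mathfrak m}/J^*_{\mathfrak m,\mathbb{Z}}$ has a representative $\mathcal A=\alpha_{\mathcal A}\mathcal{O}_K$ with $\alpha_{\mathcal A}\equiv 1\pmod{4\mathcal{O}_K}$. (2) If $n=2m$, then for a class $[\mathcal A]$ with representative $\mathcal A=\alpha_{\mathcal A}\mathcal{O}_K$, $\alpha_{\mathcal A}\equiv1\pmod{4\mathcal{O}_K}$, there is a class $[\mathcal B]\ne[\mathcal A]$ with a representative $\mathcal B=\alpha_{\mathcal B}\mathcal{O}_K$ such that $\alpha_{\mathcal B}\equiv 3+2i\pmod{4\mathcal{O}_K}$ and $\alpha_{\mathcal B}\equiv\alpha_{\mathcal A}\pmod{m\mathcal{O}_K}$. Consequently, fixing $\delta\in\mathcal{O}_K$ with $\delta\equiv 3+2i\pmod{4\mathcal{O}_K}$ and $\delta\equiv 1\pmod{m\mathcal{O}_K}$, one has $J^*_{\mathfrak m}/J^*_{\mathfrak m,\mathbb{Z}}=\{[\mathcal A],[\delta\mathcal A]:\ \mathcal A=\alpha_{\mathcal A}\mathcal{O}_K,\ \alpha_{\mathcal A}\equiv 1\pmod{4\mathcal{O}_K}\}$.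
   Context: $K=\mathbb{Q}(i)$, $\mathcal{O}_K=\mathbb{Z}[i]$. $\mathfrak m=(2+2i)n\mathcal{O}_K$ if $n$ odd, $\mathfrak m=2n\mathcal{O}_K$ if $n$ even. $J^*_{\mathfrak m}$ is the group generated by integral ideals coprime to $\mathfrak m$; $J^*_{\mathfrak m,\mathbb{Z}}$ is its subgroup generated by principal ideals $\alpha\mathcal{O}_K$ with $\alpha\equiv 1\pmod{(2+2i)\mathcal{O}_K}$ and $\alpha\equiv\ell\pmod{n\mathcal{O}_K}$ for some integer $\ell$ coprime to $n$ (if $n$ odd), resp. $\alpha\equiv1\pmod{4\mathcal{O}_K}$ and $\alpha\equiv\ell\pmod{m\mathcal{O}_K}$ for some integer $\ell$ coprime to $n$ (if $n=2m$). -}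

module Defs where

open import Data.Nat as ℕ using (ℕ)
open import Data.Nat.Divisibility as ℕD using ()
open import Data.Nat.Coprimality using (Coprime)
open import Data.Integer as ℤ using (ℤ; +_; ∣_∣)
open import Data.Product using (Σ; ∃; ∃₂; _×_; _,_)
open import Relation.Binary.PropositionalEquality using (_≡_)
open import Relation.Nullary using (¬_)

-- Gaussian integers O_K = ℤ[i]

record 𝔾 : Set where
  constructor gi
  field
    re : ℤ
    im : ℤ
open 𝔾 public

infixl 6 _+ᵍ_ _-ᵍ_
infixl 7 _*ᵍ_

_+ᵍ_ : 𝔾 → 𝔾 → 𝔾
gi a b +ᵍ gi c d = gi (a ℤ.+ c) (b ℤ.+ d)

_-ᵍ_ : 𝔾 → 𝔾 → 𝔾
gi a b -ᵍ gi c d = gi (a ℤ.- c) (b ℤ.- d)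

_*ᵍ_ : 𝔾 → 𝔾 → 𝔾
gi a b *ᵍ gi c d = gi (a ℤ.* c ℤ.- b ℤ.* d) (a ℤ.* d ℤ.+ b ℤ.* c)

ι : ℤ → 𝔾
ι a = gi a (+ 0)

ιℕ : ℕ → 𝔾
ιℕ n = ι (+ n)

1ᵍ : 𝔾
1ᵍ = ιℕ 1

infix 4 _∣ᵍ_
_∣ᵍ_ : 𝔾 → 𝔾 → Set
μ ∣ᵍ a = ∃ λ c → a ≡ c *ᵍ μ

infix 4 _≡_[mod_]
_≡_[mod_] : 𝔾 → 𝔾 → 𝔾 → Set
a ≡ b [mod μ ] = μ ∣ᵍ (a -ᵍ b)

IsUnit : 𝔾 → Set
IsUnit u = ∃ λ v → u *ᵍ v ≡ 1ᵍ

CoprimeTo : 𝔾 → 𝔾 → Set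
CoprimeTo α μ = ∃₂ λ x y → x *ᵍ α +ᵍ y *ᵍ μ ≡ 1ᵍ

SquareFree : ℕ → Set
SquareFree m = ∀ d → (d ℕ.* d) ℕD.∣ m → d ≡ 1

OddSquareFreePos : ℕ → Set
OddSquareFreePos m = (1 ℕ.≤ m) × ¬ (2 ℕD.∣ m) × SquareFree m

-- Fractional ideals of O_K (a PID), represented as  num·O_K / den·O_K

record Frac : Set where
  constructor _⸴_
  field
    num : 𝔾
    den : 𝔾
open Frac public

-- equality of fractional ideals:  a O / b O = c O / d O  iff  a d O = b c O
infix 4 _≈ᶠ_
_≈ᶠ_ : Frac → Frac → Set
(a ⸴ b) ≈ᶠ (c ⸴ d) = ∃ λ u → IsUnit u × a *ᵍ d ≡ u *ᵍ (b *ᵍ c)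

_·ᶠ_ : Frac → Frac → Frac
(a ⸴ b) ·ᶠ (c ⸴ d) = (a *ᵍ c) ⸴ (b *ᵍ d)

_⁻¹ᶠ : Frac → Frac
(a ⸴ b) ⁻¹ᶠ = b ⸴ a

⟨_⟩ : 𝔾 → Frac
⟨ α ⟩ = α ⸴ 1ᵍ

-- membership in J*_𝔪 (every integral ideal of O_K is principal,
-- so J*_𝔪 = { αO/βO : α, β coprime to 𝔪 })
InJ* : 𝔾 → Frac → Set
InJ* 𝔪 (a ⸴ b) = CoprimeTo a 𝔪 × CoprimeTo b 𝔪

-- membership in the subgroup generated by { γ O_K : Good γ },
-- where Good is closed under multiplication: { gO / g'O : Good g, Good g' }
InJZ : (𝔾 → Set) → Frac → Set
InJZ Good x = ∃₂ λ g g' → Good g × Good g' × x ≈ᶠ (g ⸴ g')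

SameClass : (𝔾 → Set) → Frac → Frac → Set
SameClass Good x y = InJZ Good (x ·ᶠ (y ⁻¹ᶠ))

2+2i : 𝔾
2+2i = gi (+ 2) (+ 2)

3+2i : 𝔾
3+2i = gi (+ 3) (+ 2)

4ᵍ : 𝔾
4ᵍ = ιℕ 4

𝔪odd : ℕ → 𝔾
𝔪odd n = 2+2i *ᵍ ιℕ n

GoodOdd : ℕ → 𝔾 → Set
GoodOdd n α = (α ≡ 1ᵍ [mod 2+2i ])
  × ∃ λ (ℓ : ℤ) → Coprime ∣ ℓ ∣ n × (α ≡ ι ℓ [mod ιℕ n ])

-- n = 2m even:  𝔪 = 2n O_K = 4m O_K
𝔪even : ℕ → 𝔾
𝔪even m = ιℕ (2 ℕ.* (2 ℕ.* m))

GoodEven : ℕ → 𝔾 → Set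
GoodEven m α = (α ≡ 1ᵍ [mod 4ᵍ ])
  × ∃ λ (ℓ : ℤ) → Coprime ∣ ℓ ∣ (2 ℕ.* m) × (α ≡ ι ℓ [mod ιℕ m ])

-- Every ideal of ℤ[i] is principal, so the class of a/b in J*_𝔪 is that of w = a b′ for an
-- inverse b′ of b mod 𝔪, and of anything congruent to w mod 𝔪. As (1+i) ∣ 𝔪, w is prime to
-- 1+i, and one of the units ±1, ±i moves it to 1 or 3+2i mod 4. For n odd, 𝔪 ≡ 2+2i mod 4,
-- so w + 𝔪 turns 3+2i into 1; for n = 2m, multiplying by δ, with δ² ≡ 1 mod 𝔪, does.
-- Classes of α ≡ 1 and β ≡ 3+2i mod 4 differ: β/α would be a unit times elements ≡ 1 mod 4,
-- but no unit of ℤ[i] is ≡ 3+2i mod 4.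
module Submission where

open import Defs
open import Data.Nat as ℕ using (ℕ; zero; suc; NonZero)
import Data.Nat.Properties as ℕ
open import Data.Nat.Divisibility as ℕ using ()
open import Data.Nat.Coprimality using (1-coprimeTo)
open import Data.Nat.DivMod using (_%_; _/_; m≡m%n+[m/n]*n; m%n<n)
open import Data.Integer as ℤ using (+_; -[1+_]; ∣_∣)
import Data.Integer.Properties as ℤ
open import Data.Integer.Tactic.RingSolver as ℤ-Solver using ()
open import Data.Integer.Divisibility.Signed as ℤ using (divides)
open import Data.Integer.DivMod using (_%ℕ_; _/ℕ_; a≡a%ℕn+[a/ℕn]*n; n%ℕd<d)
open import Data.Maybe using (Maybe; just; nothing)
open import Data.Product using (∃; _×_; _,_; proj₁; proj₂)
open import Data.Sum as Sum using (_⊎_; inj₁; inj₂)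
open import Data.Empty using (⊥-elim)
open import Relation.Nullary using (¬_)
open import Relation.Nullary.Decidable using (from-no)
open import Relation.Binary.Bundles using (Setoid)
open import Relation.Binary.PropositionalEquality
open import Algebra.Bundles using (CommutativeRing)
open import Algebra.Structures {A = 𝔾} _≡_ using (IsCommutativeRing)
open import Tactic.RingSolver.Core.AlmostCommutativeRing using (AlmostCommutativeRing; fromCommutativeRing)
import Tactic.RingSolver as RingSolver

-- ℤ[i] as a commutative ring

negᵍ : 𝔾 → 𝔾
negᵍ (gi a b) = gi (ℤ.- a) (ℤ.- b)

0ᵍ : 𝔾
0ᵍ = ιℕ 0

*ᵍ-comm : ∀ x y → x *ᵍ y ≡ y *ᵍ x
*ᵍ-comm (gi a b) (gi c d) = cong₂ gi (reᵉ a b c d) (imᵉ a b c d)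
  where
  reᵉ : ∀ a b c d → a ℤ.* c ℤ.- b ℤ.* d ≡ c ℤ.* a ℤ.- d ℤ.* b
  reᵉ = ℤ-Solver.solve-∀
  imᵉ : ∀ a b c d → a ℤ.* d ℤ.+ b ℤ.* c ≡ c ℤ.* b ℤ.+ d ℤ.* a
  imᵉ = ℤ-Solver.solve-∀

*ᵍ-assoc : ∀ x y z → (x *ᵍ y) *ᵍ z ≡ x *ᵍ (y *ᵍ z)
*ᵍ-assoc (gi a b) (gi c d) (gi e f) = cong₂ gi (reᵉ a b c d e f) (imᵉ a b c d e f)
  where
  reᵉ : ∀ a b c d e f → (a ℤ.* c ℤ.- b ℤ.* d) ℤ.* e ℤ.- (a ℤ.* d ℤ.+ b ℤ.* c) ℤ.* f
                       ≡ a ℤ.* (c ℤ.* e ℤ.- d ℤ.* f) ℤ.- b ℤ.* (c ℤ.* f ℤ.+ d ℤ.* e)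
  reᵉ = ℤ-Solver.solve-∀
  imᵉ : ∀ a b c d e f → (a ℤ.* c ℤ.- b ℤ.* d) ℤ.* f ℤ.+ (a ℤ.* d ℤ.+ b ℤ.* c) ℤ.* e
                       ≡ a ℤ.* (c ℤ.* f ℤ.+ d ℤ.* e) ℤ.+ b ℤ.* (c ℤ.* e ℤ.- d ℤ.* f)
  imᵉ = ℤ-Solver.solve-∀

*ᵍ-identityʳ : ∀ x → x *ᵍ 1ᵍ ≡ x
*ᵍ-identityʳ (gi a b) = cong₂ gi (reᵉ a b) (imᵉ a b)
  where
  reᵉ : ∀ a b → a ℤ.* + 1 ℤ.- b ℤ.* + 0 ≡ a
  reᵉ = ℤ-Solver.solve-∀
  imᵉ : ∀ a b → a ℤ.* + 0 ℤ.+ b ℤ.* + 1 ≡ b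
  imᵉ = ℤ-Solver.solve-∀

*ᵍ-distribˡ-+ᵍ : ∀ x y z → x *ᵍ (y +ᵍ z) ≡ x *ᵍ y +ᵍ x *ᵍ z
*ᵍ-distribˡ-+ᵍ (gi a b) (gi c d) (gi e f) = cong₂ gi (reᵉ a b c d e f) (imᵉ a b c d e f)
  where
  reᵉ : ∀ a b c d e f → a ℤ.* (c ℤ.+ e) ℤ.- b ℤ.* (d ℤ.+ f) ≡ (a ℤ.* c ℤ.- b ℤ.* d) ℤ.+ (a ℤ.* e ℤ.- b ℤ.* f)
  reᵉ = ℤ-Solver.solve-∀
  imᵉ : ∀ a b c d e f → a ℤ.* (d ℤ.+ f) ℤ.+ b ℤ.* (c ℤ.+ e) ≡ (a ℤ.* d ℤ.+ b ℤ.* c) ℤ.+ (a ℤ.* f ℤ.+ b ℤ.* e)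
  imᵉ = ℤ-Solver.solve-∀

+ᵍ-*ᵍ-isCommutativeRing : IsCommutativeRing _+ᵍ_ _*ᵍ_ negᵍ 0ᵍ 1ᵍ
+ᵍ-*ᵍ-isCommutativeRing = record
  { isRing = record
    { +-isAbelianGroup = record
      { isGroup = record
        { isMonoid = record
          { isSemigroup = record
            { isMagma = record { isEquivalence = isEquivalence ; ∙-cong = cong₂ _+ᵍ_ }
            ; assoc = λ x y z → cong₂ gi (ℤ.+-assoc (re x) (re y) (re z)) (ℤ.+-assoc (im x) (im y) (im z))
            }
          ; identity = (λ x → cong₂ gi (ℤ.+-identityˡ (re x)) (ℤ.+-identityˡ (im x)))
                     , (λ x → cong₂ gi (ℤ.+-identityʳ (re x)) (ℤ.+-identityʳ (im x)))
          }
        ; inverse = (λ x → cong₂ gi (ℤ.+-inverseˡ (re x)) (ℤ.+-inverseˡ (im x)))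
                  , (λ x → cong₂ gi (ℤ.+-inverseʳ (re x)) (ℤ.+-inverseʳ (im x)))
        ; ⁻¹-cong = cong negᵍ
        }
      ; comm = λ x y → cong₂ gi (ℤ.+-comm (re x) (re y)) (ℤ.+-comm (im x) (im y))
      }
    ; *-cong = cong₂ _*ᵍ_
    ; *-assoc = *ᵍ-assoc
    ; *-identity = (λ x → trans (*ᵍ-comm 1ᵍ x) (*ᵍ-identityʳ x)) , *ᵍ-identityʳ
    ; distrib = *ᵍ-distribˡ-+ᵍ , λ x y z → trans (*ᵍ-comm (y +ᵍ z) x)
                  (trans (*ᵍ-distribˡ-+ᵍ x y z) (cong₂ _+ᵍ_ (*ᵍ-comm x y) (*ᵍ-comm x z)))
    }
  ; *-comm = *ᵍ-comm
  }

+ᵍ-*ᵍ-commutativeRing : CommutativeRing _ _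
+ᵍ-*ᵍ-commutativeRing = record { isCommutativeRing = +ᵍ-*ᵍ-isCommutativeRing }

-- The solver closes goals by refl only if it can recognise zero coefficients.
ring : AlmostCommutativeRing _ _
ring = fromCommutativeRing +ᵍ-*ᵍ-commutativeRing isZero
  where
  isZero : ∀ x → Maybe (0ᵍ ≡ x)
  isZero (gi (+ zero) (+ zero)) = just refl
  isZero _                      = nothing

open RingSolver using (solve-∀)

ιℕ-* : ∀ m n → ιℕ (m ℕ.* n) ≡ ιℕ m *ᵍ ιℕ n
ιℕ-* m n = cong₂ gi (trans (ℤ.pos-* m n) (reᵉ (+ m) (+ n))) (imᵉ (+ m) (+ n))
  where
  reᵉ : ∀ i j → i ℤ.* j ≡ i ℤ.* j ℤ.- + 0 ℤ.* + 0
  reᵉ = ℤ-Solver.solve-∀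
  imᵉ : ∀ i j → + 0 ≡ i ℤ.* + 0 ℤ.+ + 0 ℤ.* j
  imᵉ = ℤ-Solver.solve-∀

-- Congruences

-- Defs' congruence unfolds to a Σ-type from which Agda cannot infer the two
-- sides; wrapping it in a record makes them inferable.
infix 4 _≈_[mod_]
record _≈_[mod_] (a b μ : 𝔾) : Set where
  constructor ≈-mod
  field
    ≡-mod : a ≡ b [mod μ ]
open _≈_[mod_] public

module _ {μ : 𝔾} where

  mod-intro : ∀ {a b} c → a ≡ b +ᵍ c *ᵍ μ → a ≈ b [mod μ ]
  mod-intro {b = b} c refl = ≈-mod (c , +-cancel b (c *ᵍ μ))
    where
    +-cancel : ∀ x y → x +ᵍ y +ᵍ negᵍ x ≡ y
    +-cancel = solve-∀ ring

  quotient : ∀ {a b} → a ≈ b [mod μ ] → 𝔾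
  quotient (≈-mod (c , _)) = c

  mod-elim : ∀ {a b} (a≈b : a ≈ b [mod μ ]) → a ≡ b +ᵍ quotient a≈b *ᵍ μ
  mod-elim {a} {b} (≈-mod (c , a-b≡cμ)) = begin
    a                     ≡⟨ add-sub a b ⟩
    b +ᵍ (a +ᵍ negᵍ b)    ≡⟨ cong (b +ᵍ_) a-b≡cμ ⟩
    b +ᵍ c *ᵍ μ           ∎
    where
    open ≡-Reasoning
    add-sub : ∀ x y → x ≡ y +ᵍ (x +ᵍ negᵍ y)
    add-sub = solve-∀ ring

  mod-reflexive : ∀ {a b} → a ≡ b → a ≈ b [mod μ ]
  mod-reflexive {b = b} refl = mod-intro 0ᵍ (+0* b μ)
    where
    +0* : ∀ x y → x ≡ x +ᵍ 0ᵍ *ᵍ y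
    +0* = solve-∀ ring

  mod-refl : ∀ {a} → a ≈ a [mod μ ]
  mod-refl = mod-reflexive refl

  mod-sym : ∀ {a b} → a ≈ b [mod μ ] → b ≈ a [mod μ ]
  mod-sym {a} {b} a≈b = mod-intro (negᵍ c) (begin
    b                             ≡⟨ identity b c μ ⟩
    b +ᵍ c *ᵍ μ +ᵍ negᵍ c *ᵍ μ    ≡⟨ cong (_+ᵍ negᵍ c *ᵍ μ) (mod-elim a≈b) ⟨
    a +ᵍ negᵍ c *ᵍ μ              ∎)
    where
    open ≡-Reasoning
    c : 𝔾
    c = quotient a≈b
    identity : ∀ x y z → x ≡ x +ᵍ y *ᵍ z +ᵍ negᵍ y *ᵍ z
    identity = solve-∀ ring

  mod-trans : ∀ {a b d} → a ≈ b [mod μ ] → b ≈ d [mod μ ] → a ≈ d [mod μ ]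
  mod-trans {a} {b} {d} a≈b b≈d = mod-intro (e +ᵍ c) (begin
    a                        ≡⟨ mod-elim a≈b ⟩
    b +ᵍ c *ᵍ μ              ≡⟨ cong (_+ᵍ c *ᵍ μ) (mod-elim b≈d) ⟩
    d +ᵍ e *ᵍ μ +ᵍ c *ᵍ μ    ≡⟨ identity d e c μ ⟩
    d +ᵍ (e +ᵍ c) *ᵍ μ       ∎)
    where
    open ≡-Reasoning
    c : 𝔾
    c = quotient a≈b
    e : 𝔾
    e = quotient b≈d
    identity : ∀ x y z w → x +ᵍ y *ᵍ w +ᵍ z *ᵍ w ≡ x +ᵍ (y +ᵍ z) *ᵍ w
    identity = solve-∀ ring

  mod-+ : ∀ {a b c d} → a ≈ b [mod μ ] → c ≈ d [mod μ ] → a +ᵍ c ≈ b +ᵍ d [mod μ ]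
  mod-+ {b = b} {d = d} a≈b c≈d = mod-intro (k +ᵍ l) (begin
    _                                  ≡⟨ cong₂ _+ᵍ_ (mod-elim a≈b) (mod-elim c≈d) ⟩
    (b +ᵍ k *ᵍ μ) +ᵍ (d +ᵍ l *ᵍ μ)    ≡⟨ identity b d k l μ ⟩
    b +ᵍ d +ᵍ (k +ᵍ l) *ᵍ μ           ∎)
    where
    open ≡-Reasoning
    k : 𝔾
    k = quotient a≈b
    l : 𝔾
    l = quotient c≈d
    identity : ∀ x y k l w → (x +ᵍ k *ᵍ w) +ᵍ (y +ᵍ l *ᵍ w) ≡ x +ᵍ y +ᵍ (k +ᵍ l) *ᵍ w
    identity = solve-∀ ring

  mod-* : ∀ {a b c d} → a ≈ b [mod μ ] → c ≈ d [mod μ ] → a *ᵍ c ≈ b *ᵍ d [mod μ ]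
  mod-* {b = b} {d = d} a≈b c≈d = mod-intro (k *ᵍ d +ᵍ b *ᵍ l +ᵍ k *ᵍ l *ᵍ μ) (begin
    _                                  ≡⟨ cong₂ _*ᵍ_ (mod-elim a≈b) (mod-elim c≈d) ⟩
    (b +ᵍ k *ᵍ μ) *ᵍ (d +ᵍ l *ᵍ μ)    ≡⟨ identity b d k l μ ⟩
    b *ᵍ d +ᵍ (k *ᵍ d +ᵍ b *ᵍ l +ᵍ k *ᵍ l *ᵍ μ) *ᵍ μ ∎)
    where
    open ≡-Reasoning
    k : 𝔾
    k = quotient a≈b
    l : 𝔾
    l = quotient c≈d
    identity : ∀ x y k l w → (x +ᵍ k *ᵍ w) *ᵍ (y +ᵍ l *ᵍ w) ≡ x *ᵍ y +ᵍ (k *ᵍ y +ᵍ x *ᵍ l +ᵍ k *ᵍ l *ᵍ w) *ᵍ w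
    identity = solve-∀ ring

  mod-*ˡ : ∀ {a b} c → a ≈ b [mod μ ] → c *ᵍ a ≈ c *ᵍ b [mod μ ]
  mod-*ˡ c = mod-* (mod-refl {c})

≈[mod]-setoid : 𝔾 → Setoid _ _
≈[mod]-setoid μ = record
  { Carrier = 𝔾
  ; _≈_ = _≈_[mod μ ]
  ; isEquivalence = record { refl = mod-refl ; sym = mod-sym ; trans = mod-trans }
  }

module ≈[mod]-Reasoning (μ : 𝔾) where
  open import Relation.Binary.Reasoning.Setoid (≈[mod]-setoid μ) public

open CommutativeRing +ᵍ-*ᵍ-commutativeRing using (+-comm; *-identityˡ)

∣ᵍ-trans : ∀ {a b c} → a ∣ᵍ b → b ∣ᵍ c → a ∣ᵍ c
∣ᵍ-trans {a} (k , refl) (l , refl) = l *ᵍ k , sym (*ᵍ-assoc l k a)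

∣ᵍ-resp-mod : ∀ {d μ a b} → d ∣ᵍ μ → a ≈ b [mod μ ] → d ∣ᵍ b → d ∣ᵍ a
∣ᵍ-resp-mod {d} (k , refl) a≈b (l , refl) = l +ᵍ quotient a≈b *ᵍ k , trans (mod-elim a≈b) (identity l (quotient a≈b) k d)
  where
  identity : ∀ l c k d → l *ᵍ d +ᵍ c *ᵍ (k *ᵍ d) ≡ (l +ᵍ c *ᵍ k) *ᵍ d
  identity = solve-∀ ring

mod-∣ : ∀ {ν μ a b} → ν ∣ᵍ μ → a ≈ b [mod μ ] → a ≈ b [mod ν ]
mod-∣ {ν} {b = b} (k , refl) a≈b = mod-intro (quotient a≈b *ᵍ k) (trans (mod-elim a≈b) (identity b (quotient a≈b) k ν))
  where
  identity : ∀ b c k ν → b +ᵍ c *ᵍ (k *ᵍ ν) ≡ b +ᵍ c *ᵍ k *ᵍ ν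
  identity = solve-∀ ring

mod-scale : ∀ {μ a b} c → a ≈ b [mod μ ] → c *ᵍ a ≈ c *ᵍ b [mod c *ᵍ μ ]
mod-scale {μ} {b = b} c a≈b = mod-intro (quotient a≈b) (trans (cong (c *ᵍ_) (mod-elim a≈b)) (identity c b (quotient a≈b) μ))
  where
  identity : ∀ c b k μ → c *ᵍ (b +ᵍ k *ᵍ μ) ≡ c *ᵍ b +ᵍ k *ᵍ (c *ᵍ μ)
  identity = solve-∀ ring

mod-crt : ∀ {μ ν a b} → CoprimeTo μ ν → a ≈ b [mod μ ] → a ≈ b [mod ν ] → a ≈ b [mod μ *ᵍ ν ]
mod-crt {μ} {ν} {a} {b} (x , y , xμ+yν≡1) (≈-mod (k , a-b≡kμ)) (≈-mod (l , a-b≡lν)) =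
  mod-intro (x *ᵍ l +ᵍ y *ᵍ k) (sym (begin
    b +ᵍ (x *ᵍ l +ᵍ y *ᵍ k) *ᵍ (μ *ᵍ ν)                     ≡⟨ expand b x y k l μ ν ⟩
    b +ᵍ x *ᵍ μ *ᵍ (l *ᵍ ν) +ᵍ y *ᵍ ν *ᵍ (k *ᵍ μ)           ≡⟨ cong₂ (λ p q → b +ᵍ x *ᵍ μ *ᵍ p +ᵍ y *ᵍ ν *ᵍ q) a-b≡lν a-b≡kμ ⟨
    b +ᵍ x *ᵍ μ *ᵍ (a +ᵍ negᵍ b) +ᵍ y *ᵍ ν *ᵍ (a +ᵍ negᵍ b)  ≡⟨ collect b (a +ᵍ negᵍ b) (x *ᵍ μ) (y *ᵍ ν) ⟩
    b +ᵍ (x *ᵍ μ +ᵍ y *ᵍ ν) *ᵍ (a +ᵍ negᵍ b)                 ≡⟨ cong (λ s → b +ᵍ s *ᵍ (a +ᵍ negᵍ b)) xμ+yν≡1 ⟩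
    b +ᵍ 1ᵍ *ᵍ (a +ᵍ negᵍ b)                                ≡⟨ cancel a b ⟩
    a                                                       ∎))
  where
  open ≡-Reasoning
  expand : ∀ b x y k l μ ν → b +ᵍ (x *ᵍ l +ᵍ y *ᵍ k) *ᵍ (μ *ᵍ ν) ≡ b +ᵍ x *ᵍ μ *ᵍ (l *ᵍ ν) +ᵍ y *ᵍ ν *ᵍ (k *ᵍ μ)
  expand = solve-∀ ring
  collect : ∀ b d s t → b +ᵍ s *ᵍ d +ᵍ t *ᵍ d ≡ b +ᵍ (s +ᵍ t) *ᵍ d
  collect = solve-∀ ring
  cancel : ∀ a b → b +ᵍ 1ᵍ *ᵍ (a +ᵍ negᵍ b) ≡ a
  cancel = solve-∀ ring

-- Coprimality

module _ {μ : 𝔾} where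

  coprime⇒inverse : ∀ {a} → CoprimeTo a μ → ∃ λ a′ → a′ *ᵍ a ≈ 1ᵍ [mod μ ]
  coprime⇒inverse {a} (x , y , xa+yμ≡1) = x , mod-intro (negᵍ y) (begin
    x *ᵍ a                              ≡⟨ identity (x *ᵍ a) y μ ⟩
    x *ᵍ a +ᵍ y *ᵍ μ +ᵍ negᵍ y *ᵍ μ     ≡⟨ cong (_+ᵍ negᵍ y *ᵍ μ) xa+yμ≡1 ⟩
    1ᵍ +ᵍ negᵍ y *ᵍ μ                   ∎)
    where
    open ≡-Reasoning
    identity : ∀ s y μ → s ≡ s +ᵍ y *ᵍ μ +ᵍ negᵍ y *ᵍ μ
    identity = solve-∀ ring

  inverse⇒coprime : ∀ a a′ → a′ *ᵍ a ≈ 1ᵍ [mod μ ] → CoprimeTo a μ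
  inverse⇒coprime a a′ a′a≈1 = a′ , negᵍ k , (begin
    a′ *ᵍ a +ᵍ negᵍ k *ᵍ μ          ≡⟨ cong (_+ᵍ negᵍ k *ᵍ μ) (mod-elim a′a≈1) ⟩
    1ᵍ +ᵍ k *ᵍ μ +ᵍ negᵍ k *ᵍ μ     ≡⟨ cancel 1ᵍ k μ ⟩
    1ᵍ                              ∎)
    where
    open ≡-Reasoning
    k : 𝔾
    k = quotient a′a≈1
    cancel : ∀ s k μ → s +ᵍ k *ᵍ μ +ᵍ negᵍ k *ᵍ μ ≡ s
    cancel = solve-∀ ring

  coprime-* : ∀ a b → CoprimeTo a μ → CoprimeTo b μ → CoprimeTo (a *ᵍ b) μ
  coprime-* a b a-coprime b-coprime =
    let a′ , a′a≈1 = coprime⇒inverse a-coprime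
        b′ , b′b≈1 = coprime⇒inverse b-coprime
    in inverse⇒coprime (a *ᵍ b) (a′ *ᵍ b′) (begin
      (a′ *ᵍ b′) *ᵍ (a *ᵍ b)   ≡⟨ interchange a′ b′ a b ⟩
      (a′ *ᵍ a) *ᵍ (b′ *ᵍ b)   ≈⟨ mod-* a′a≈1 b′b≈1 ⟩
      1ᵍ                       ∎)
    where
    open ≈[mod]-Reasoning μ
    interchange : ∀ w x y z → (w *ᵍ x) *ᵍ (y *ᵍ z) ≡ (w *ᵍ y) *ᵍ (x *ᵍ z)
    interchange = solve-∀ ring

  coprime-resp-mod : ∀ {a b} → a ≈ b [mod μ ] → CoprimeTo b μ → CoprimeTo a μ
  coprime-resp-mod {a} a≈b b-coprime =
    let b′ , b′b≈1 = coprime⇒inverse b-coprime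
    in inverse⇒coprime a b′ (mod-trans (mod-*ˡ b′ a≈b) b′b≈1)

  unit⇒coprime : ∀ u → IsUnit u → CoprimeTo u μ
  unit⇒coprime u (v , uv≡1) = inverse⇒coprime u v (mod-reflexive (trans (*ᵍ-comm v u) uv≡1))

coprime-sym : ∀ a μ → CoprimeTo a μ → CoprimeTo μ a
coprime-sym a μ (x , y , xa+yμ≡1) = y , x , trans (+-comm (y *ᵍ μ) (x *ᵍ a)) xa+yμ≡1

coprime∧common-divisor⇒unit : ∀ {a μ d} → CoprimeTo a μ → d ∣ᵍ a → d ∣ᵍ μ → IsUnit d
coprime∧common-divisor⇒unit {d = d} (x , y , xa+yμ≡1) (k , refl) (l , refl) =
  x *ᵍ k +ᵍ y *ᵍ l , trans (identity x y k l d) xa+yμ≡1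
  where
  identity : ∀ x y k l d → d *ᵍ (x *ᵍ k +ᵍ y *ᵍ l) ≡ x *ᵍ (k *ᵍ d) +ᵍ y *ᵍ (l *ᵍ d)
  identity = solve-∀ ring

-- Norms and units

1+i : 𝔾
1+i = gi (+ 1) (+ 1)

norm : 𝔾 → ℕ
norm (gi a b) = ∣ a ∣ ℕ.* ∣ a ∣ ℕ.+ ∣ b ∣ ℕ.* ∣ b ∣

+∣i∣*∣i∣≡i*i : ∀ i → + (∣ i ∣ ℕ.* ∣ i ∣) ≡ i ℤ.* i
+∣i∣*∣i∣≡i*i (+ n)    = ℤ.pos-* n n
+∣i∣*∣i∣≡i*i -[1+ n ] = refl

+norm : ∀ x → + norm x ≡ re x ℤ.* re x ℤ.+ im x ℤ.* im x
+norm (gi a b) = cong₂ ℤ._+_ (+∣i∣*∣i∣≡i*i a) (+∣i∣*∣i∣≡i*i b)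

norm-* : ∀ x y → norm (x *ᵍ y) ≡ norm x ℕ.* norm y
norm-* x@(gi a b) y@(gi c d) = ℤ.+-injective (begin
  + norm (x *ᵍ y)                                                       ≡⟨ +norm (x *ᵍ y) ⟩
  (a ℤ.* c ℤ.- b ℤ.* d) ℤ.* (a ℤ.* c ℤ.- b ℤ.* d)
    ℤ.+ (a ℤ.* d ℤ.+ b ℤ.* c) ℤ.* (a ℤ.* d ℤ.+ b ℤ.* c)                ≡⟨ two-squares a b c d ⟩
  (a ℤ.* a ℤ.+ b ℤ.* b) ℤ.* (c ℤ.* c ℤ.+ d ℤ.* d)                      ≡⟨ cong₂ ℤ._*_ (+norm x) (+norm y) ⟨
  + norm x ℤ.* + norm y                                                 ≡⟨ ℤ.pos-* (norm x) (norm y) ⟨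
  + (norm x ℕ.* norm y)                                                 ∎)
  where
  open ≡-Reasoning
  two-squares : ∀ a b c d → (a ℤ.* c ℤ.- b ℤ.* d) ℤ.* (a ℤ.* c ℤ.- b ℤ.* d)
                              ℤ.+ (a ℤ.* d ℤ.+ b ℤ.* c) ℤ.* (a ℤ.* d ℤ.+ b ℤ.* c)
                            ≡ (a ℤ.* a ℤ.+ b ℤ.* b) ℤ.* (c ℤ.* c ℤ.+ d ℤ.* d)
  two-squares = ℤ-Solver.solve-∀

unit⇒norm≡1 : ∀ u → IsUnit u → norm u ≡ 1
unit⇒norm≡1 u (v , uv≡1) = ℕ.m*n≡1⇒m≡1 (norm u) (norm v) (trans (sym (norm-* u v)) (cong norm uv≡1))

1+i-nonunit : ¬ IsUnit 1+i
1+i-nonunit 1+i-unit with unit⇒norm≡1 1+i 1+i-unit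
... | ()

m*m+n*n≡1⇒m≡0⊎n≡0 : ∀ m n → m ℕ.* m ℕ.+ n ℕ.* n ≡ 1 → m ≡ 0 ⊎ n ≡ 0
m*m+n*n≡1⇒m≡0⊎n≡0 zero    _       _  = inj₁ refl
m*m+n*n≡1⇒m≡0⊎n≡0 (suc _) zero    _  = inj₂ refl
m*m+n*n≡1⇒m≡0⊎n≡0 (suc m) (suc n) eq = ⊥-elim (ℕ.m+1+n≢0 (m ℕ.+ m ℕ.* suc m) (ℕ.suc-injective eq))

norm≡1⇒re≡0⊎im≡0 : ∀ x → norm x ≡ 1 → re x ≡ + 0 ⊎ im x ≡ + 0
norm≡1⇒re≡0⊎im≡0 (gi a b) eq = Sum.map ℤ.∣i∣≡0⇒i≡0 ℤ.∣i∣≡0⇒i≡0 (m*m+n*n≡1⇒m≡0⊎n≡0 ∣ a ∣ ∣ b ∣ eq)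

mod-ι⇒∣re×∣im : ∀ {a b k} → a ≈ b [mod ι k ] → k ℤ.∣ re a ℤ.- re b × k ℤ.∣ im a ℤ.- im b
mod-ι⇒∣re×∣im {k = k} (≈-mod (gi c d , a-b≡ck)) =
  divides c (trans (cong re a-b≡ck) (reᵉ c d k)) , divides d (trans (cong im a-b≡ck) (imᵉ c d k))
  where
  reᵉ : ∀ c d k → c ℤ.* k ℤ.- d ℤ.* + 0 ≡ c ℤ.* k
  reᵉ = ℤ-Solver.solve-∀
  imᵉ : ∀ c d k → c ℤ.* + 0 ℤ.+ d ℤ.* k ≡ d ℤ.* k
  imᵉ = ℤ-Solver.solve-∀

-- A unit has a zero coordinate, while both coordinates of 3+2i are nonzero mod 4.
unit≉3+2i[mod4] : ∀ {u} → IsUnit u → ¬ u ≈ 3+2i [mod 4ᵍ ]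
unit≉3+2i[mod4] {u} u-unit u≈3+2i with norm≡1⇒re≡0⊎im≡0 u (unit⇒norm≡1 u u-unit)
... | inj₁ re≡0 = from-no (+ 4 ℤ.∣? -[1+ 2 ]) (subst (λ r → + 4 ℤ.∣ r ℤ.- + 3) re≡0 (proj₁ (mod-ι⇒∣re×∣im u≈3+2i)))
... | inj₂ im≡0 = from-no (+ 4 ℤ.∣? -[1+ 1 ]) (subst (λ r → + 4 ℤ.∣ r ℤ.- + 2) im≡0 (proj₂ (mod-ι⇒∣re×∣im u≈3+2i)))

residue : (k : ℕ) .{{_ : NonZero k}} → 𝔾 → 𝔾
residue k w = gi (+ (re w %ℕ k)) (+ (im w %ℕ k))

≈residue : ∀ k .{{_ : NonZero k}} w → w ≈ residue k w [mod ιℕ k ]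
≈residue k (gi p q) = mod-intro (gi (p /ℕ k) (q /ℕ k))
  (cong₂ gi (trans (a≡a%ℕn+[a/ℕn]*n p k) (reᵉ (+ (p %ℕ k)) (p /ℕ k) (q /ℕ k) (+ k)))
            (trans (a≡a%ℕn+[a/ℕn]*n q k) (imᵉ (+ (q %ℕ k)) (p /ℕ k) (q /ℕ k) (+ k))))
  where
  reᵉ : ∀ r s t k → r ℤ.+ s ℤ.* k ≡ r ℤ.+ (s ℤ.* k ℤ.- t ℤ.* + 0)
  reᵉ = ℤ-Solver.solve-∀
  imᵉ : ∀ r s t k → r ℤ.+ t ℤ.* k ≡ r ℤ.+ (s ℤ.* + 0 ℤ.+ t ℤ.* k)
  imᵉ = ℤ-Solver.solve-∀

3+2i*3+2i≈1[mod4] : 3+2i *ᵍ 3+2i ≈ 1ᵍ [mod 4ᵍ ]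
3+2i*3+2i≈1[mod4] = ≈-mod (gi (+ 1) (+ 3) , refl)

-- (ℤ[i]/4)^× has order 8, and the units ±1, ±i split it into the classes of 1 and 3+2i.
HasAssociate≈1∨3+2i : 𝔾 → Set
HasAssociate≈1∨3+2i w = ∃ λ u → IsUnit u × (u *ᵍ w ≈ 1ᵍ [mod 4ᵍ ] ⊎ u *ᵍ w ≈ 3+2i [mod 4ᵍ ])

-1ᵍ iᵍ -iᵍ : 𝔾
-1ᵍ = gi -[1+ 0 ] (+ 0)
iᵍ  = gi (+ 0) (+ 1)
-iᵍ = gi (+ 0) -[1+ 0 ]

residue-mod4 : ∀ r s → r ℕ.< 4 → s ℕ.< 4 → 1+i ∣ᵍ gi (+ r) (+ s) ⊎ HasAssociate≈1∨3+2i (gi (+ r) (+ s))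
residue-mod4 0 0 _ _ = inj₁ (0ᵍ , refl)
residue-mod4 2 0 _ _ = inj₁ (gi (+ 1) -[1+ 0 ] , refl)
residue-mod4 1 1 _ _ = inj₁ (1ᵍ , refl)
residue-mod4 3 1 _ _ = inj₁ (gi (+ 2) -[1+ 0 ] , refl)
residue-mod4 0 2 _ _ = inj₁ (1+i , refl)
residue-mod4 2 2 _ _ = inj₁ (ιℕ 2 , refl)
residue-mod4 1 3 _ _ = inj₁ (gi (+ 2) (+ 1) , refl)
residue-mod4 3 3 _ _ = inj₁ (ιℕ 3 , refl)
residue-mod4 1 0 _ _ = inj₂ (1ᵍ  , (1ᵍ  , refl) , inj₁ (≈-mod (0ᵍ , refl)))
residue-mod4 3 0 _ _ = inj₂ (-1ᵍ , (-1ᵍ , refl) , inj₁ (≈-mod (-1ᵍ , refl)))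
residue-mod4 0 1 _ _ = inj₂ (-iᵍ , (iᵍ  , refl) , inj₁ (≈-mod (0ᵍ , refl)))
residue-mod4 0 3 _ _ = inj₂ (iᵍ  , (-iᵍ , refl) , inj₁ (≈-mod (-1ᵍ , refl)))
residue-mod4 3 2 _ _ = inj₂ (1ᵍ  , (1ᵍ  , refl) , inj₂ (≈-mod (0ᵍ , refl)))
residue-mod4 1 2 _ _ = inj₂ (-1ᵍ , (-1ᵍ , refl) , inj₂ (≈-mod (gi -[1+ 0 ] -[1+ 0 ] , refl)))
residue-mod4 2 1 _ _ = inj₂ (iᵍ  , (-iᵍ , refl) , inj₂ (≈-mod (-1ᵍ , refl)))
residue-mod4 2 3 _ _ = inj₂ (-iᵍ , (iᵍ  , refl) , inj₂ (≈-mod (-iᵍ , refl)))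
residue-mod4 (suc (suc (suc (suc _)))) _ (ℕ.s≤s (ℕ.s≤s (ℕ.s≤s (ℕ.s≤s ())))) _
residue-mod4 _ (suc (suc (suc (suc _)))) _ (ℕ.s≤s (ℕ.s≤s (ℕ.s≤s (ℕ.s≤s ()))))

coprime⇒associate≈1∨3+2i : ∀ {μ} w → 1+i ∣ᵍ μ → CoprimeTo w μ → HasAssociate≈1∨3+2i w
coprime⇒associate≈1∨3+2i w 1+i∣μ w-coprime =
  Sum.[ (λ 1+i∣ρ → ⊥-elim (1+i-nonunit (coprime∧common-divisor⇒unit w-coprime (1+i∣w 1+i∣ρ) 1+i∣μ)))
      , (λ (u , u-unit , uρ≈1∨3+2i) → u , u-unit , Sum.map (mod-trans (uw≈uρ u)) (mod-trans (uw≈uρ u)) uρ≈1∨3+2i)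
      ]′ (residue-mod4 (re w %ℕ 4) (im w %ℕ 4) (n%ℕd<d (re w) 4) (n%ℕd<d (im w) 4))
  where
  1+i∣w : 1+i ∣ᵍ residue 4 w → 1+i ∣ᵍ w
  1+i∣w = ∣ᵍ-resp-mod (gi (+ 2) -[1+ 1 ] , refl) (≈residue 4 w)
  uw≈uρ : ∀ u → u *ᵍ w ≈ u *ᵍ residue 4 w [mod 4ᵍ ]
  uw≈uρ u = mod-*ˡ u (≈residue 4 w)

-- Classes of J*_μ / J*_{μ,ℤ}

-- A representative, normalised mod 4, of the class of x in J*_μ / J*_{μ,ℤ},
-- where Good generates J*_{μ,ℤ}.
record ClassRep (Good : 𝔾 → Set) (μ : 𝔾) (x : Frac) : Set where
  field
    rep         : 𝔾
    rep-coprime : CoprimeTo rep μ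
    rep≈1∨3+2i  : rep ≈ 1ᵍ [mod 4ᵍ ] ⊎ rep ≈ 3+2i [mod 4ᵍ ]
    represents  : ∀ θ → θ ≈ rep [mod μ ] → SameClass Good x ⟨ θ ⟩

module _ (Good : 𝔾 → Set) {μ : 𝔾} (≈1⇒Good : ∀ g → g ≈ 1ᵍ [mod μ ] → Good g) where

  -- With θ′ an inverse of θ mod μ, the quotient (a/b)/θ equals g/g′ up to a unit,
  -- for g = θ′ u a b′ ≡ 1 and g′ = b′ b θ′ θ ≡ 1 mod μ.
  ≈unit*a*b′⇒sameClass : ∀ a b b′ u θ → b′ *ᵍ b ≈ 1ᵍ [mod μ ] → IsUnit u → CoprimeTo θ μ →
                         θ ≈ u *ᵍ (a *ᵍ b′) [mod μ ] → SameClass Good (a ⸴ b) ⟨ θ ⟩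
  ≈unit*a*b′⇒sameClass a b b′ u θ b′b≈1 (v , uv≡1) θ-coprime θ≈uab′ =
    let θ′ , θ′θ≈1 = coprime⇒inverse θ-coprime
        g : 𝔾
        g = θ′ *ᵍ (u *ᵍ (a *ᵍ b′))
        g′ : 𝔾
        g′ = (b′ *ᵍ b) *ᵍ (θ′ *ᵍ θ)
        g≈1 : g ≈ 1ᵍ [mod μ ]
        g≈1 = mod-trans (mod-*ˡ θ′ (mod-sym θ≈uab′)) θ′θ≈1
    in g , g′ , ≈1⇒Good g g≈1 , ≈1⇒Good g′ (mod-* b′b≈1 θ′θ≈1) , v , (u , trans (*ᵍ-comm v u) uv≡1) ,
       (begin
         (a *ᵍ 1ᵍ) *ᵍ ((b′ *ᵍ b) *ᵍ (θ′ *ᵍ θ))          ≡⟨ gather a b b′ θ θ′ ⟩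
         1ᵍ *ᵍ (a *ᵍ b *ᵍ b′ *ᵍ θ *ᵍ θ′)                ≡⟨ cong (_*ᵍ (a *ᵍ b *ᵍ b′ *ᵍ θ *ᵍ θ′)) uv≡1 ⟨
         (u *ᵍ v) *ᵍ (a *ᵍ b *ᵍ b′ *ᵍ θ *ᵍ θ′)          ≡⟨ scatter a b b′ θ θ′ u v ⟩
         v *ᵍ ((b *ᵍ θ) *ᵍ (θ′ *ᵍ (u *ᵍ (a *ᵍ b′))))    ∎)
    where
    open ≡-Reasoning
    gather : ∀ a b b′ θ θ′ → (a *ᵍ 1ᵍ) *ᵍ ((b′ *ᵍ b) *ᵍ (θ′ *ᵍ θ)) ≡ 1ᵍ *ᵍ (a *ᵍ b *ᵍ b′ *ᵍ θ *ᵍ θ′)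
    gather = solve-∀ ring
    scatter : ∀ a b b′ θ θ′ u v → (u *ᵍ v) *ᵍ (a *ᵍ b *ᵍ b′ *ᵍ θ *ᵍ θ′) ≡ v *ᵍ ((b *ᵍ θ) *ᵍ (θ′ *ᵍ (u *ᵍ (a *ᵍ b′))))
    scatter = solve-∀ ring

  J*-classRep : 1+i ∣ᵍ μ → ∀ x → InJ* μ x → ClassRep Good μ x
  J*-classRep 1+i∣μ (a ⸴ b) (a-coprime , b-coprime) =
    let b′ , b′b≈1 = coprime⇒inverse b-coprime
        ab′-coprime = coprime-* a b′ a-coprime (inverse⇒coprime b′ b (mod-trans (mod-reflexive (*ᵍ-comm b b′)) b′b≈1))
        u , u-unit , uab′≈1∨3+2i = coprime⇒associate≈1∨3+2i (a *ᵍ b′) 1+i∣μ ab′-coprime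
        uab′-coprime = coprime-* u (a *ᵍ b′) (unit⇒coprime u u-unit) ab′-coprime
    in record
      { rep         = u *ᵍ (a *ᵍ b′)
      ; rep-coprime = uab′-coprime
      ; rep≈1∨3+2i  = uab′≈1∨3+2i
      ; represents  = λ θ θ≈uab′ →
          ≈unit*a*b′⇒sameClass a b b′ u θ b′b≈1 u-unit (coprime-resp-mod θ≈uab′ uab′-coprime) θ≈uab′
      }

module _ (Good : 𝔾 → Set) (Good⇒≈1 : ∀ {g} → Good g → g ≈ 1ᵍ [mod 4ᵍ ]) where

  ≈1∧≈3+2i⇒¬sameClass : ∀ {α β} → α ≈ 1ᵍ [mod 4ᵍ ] → β ≈ 3+2i [mod 4ᵍ ] → ¬ SameClass Good ⟨ β ⟩ ⟨ α ⟩
  ≈1∧≈3+2i⇒¬sameClass {α} {β} α≈1 β≈3+2i (g , g′ , good-g , good-g′ , u , u-unit , βg′≡uαg) =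
    unit≉3+2i[mod4] u-unit (begin
      u                           ≡⟨ *ᵍ-identityʳ u ⟨
      u *ᵍ ((1ᵍ *ᵍ 1ᵍ) *ᵍ 1ᵍ)     ≈⟨ mod-*ˡ u (mod-* (mod-*ˡ 1ᵍ α≈1) (Good⇒≈1 good-g)) ⟨
      u *ᵍ ((1ᵍ *ᵍ α) *ᵍ g)       ≡⟨ βg′≡uαg ⟨
      (β *ᵍ 1ᵍ) *ᵍ g′             ≈⟨ mod-* (mod-* β≈3+2i mod-refl) (Good⇒≈1 good-g′) ⟩
      3+2i                        ∎)
    where
    open ≈[mod]-Reasoning 4ᵍ

module _ {Good : 𝔾 → Set} {μ : 𝔾} {x : Frac} where

  -- For w ≡ 3+2i take w + μ ≡ 3+2i + 2+2i ≡ 1 mod 4.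
  classRep⇒≈1 : μ ≈ 2+2i [mod 4ᵍ ] → ClassRep Good μ x →
    ∃ λ α → CoprimeTo α μ × (α ≡ 1ᵍ [mod 4ᵍ ]) × SameClass Good x ⟨ α ⟩
  classRep⇒≈1 _ record { rep = w ; rep-coprime = w-coprime ; rep≈1∨3+2i = inj₁ w≈1 ; represents = w-represents } =
    w , w-coprime , ≡-mod w≈1 , w-represents w mod-refl
  classRep⇒≈1 μ≈2+2i record { rep = w ; rep-coprime = w-coprime ; rep≈1∨3+2i = inj₂ w≈3+2i ; represents = w-represents } =
    w +ᵍ μ , coprime-resp-mod w+μ≈w w-coprime , ≡-mod w+μ≈1 , w-represents (w +ᵍ μ) w+μ≈w
    where
    w+μ≈w : w +ᵍ μ ≈ w [mod μ ]
    w+μ≈w = mod-intro 1ᵍ (cong (w +ᵍ_) (sym (*-identityˡ μ)))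
    w+μ≈1 : w +ᵍ μ ≈ 1ᵍ [mod 4ᵍ ]
    w+μ≈1 = mod-trans (mod-+ w≈3+2i μ≈2+2i) (≈-mod (1+i , refl))

  -- For w ≡ 3+2i take α = w δ ≡ (3+2i)² ≡ 1 mod 4; then δ α ≡ w mod μ as δ² ≡ 1.
  classRep⇒≈1∨δ : ∀ δ → δ *ᵍ δ ≈ 1ᵍ [mod μ ] → δ ≈ 3+2i [mod 4ᵍ ] → ClassRep Good μ x →
    ∃ λ α → CoprimeTo α μ × (α ≡ 1ᵍ [mod 4ᵍ ]) × (SameClass Good x ⟨ α ⟩ ⊎ SameClass Good x ⟨ δ *ᵍ α ⟩)
  classRep⇒≈1∨δ δ δδ≈1 δ≈3+2i record { rep = w ; rep-coprime = w-coprime ; rep≈1∨3+2i = inj₁ w≈1 ; represents = w-represents } =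
    w , w-coprime , ≡-mod w≈1 , inj₁ (w-represents w mod-refl)
  classRep⇒≈1∨δ δ δδ≈1 δ≈3+2i record { rep = w ; rep-coprime = w-coprime ; rep≈1∨3+2i = inj₂ w≈3+2i ; represents = w-represents } =
    w *ᵍ δ , coprime-* w δ w-coprime (inverse⇒coprime δ δ δδ≈1) , ≡-mod wδ≈1 , inj₂ (w-represents (δ *ᵍ (w *ᵍ δ)) δwδ≈w)
    where
    wδ≈1 : w *ᵍ δ ≈ 1ᵍ [mod 4ᵍ ]
    wδ≈1 = mod-trans (mod-* w≈3+2i δ≈3+2i) 3+2i*3+2i≈1[mod4]
    δwδ≈w : δ *ᵍ (w *ᵍ δ) ≈ w [mod μ ]
    δwδ≈w = begin
      δ *ᵍ (w *ᵍ δ)   ≡⟨ rearrange δ w ⟩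
      w *ᵍ (δ *ᵍ δ)   ≈⟨ mod-*ˡ w δδ≈1 ⟩
      w *ᵍ 1ᵍ         ≡⟨ *ᵍ-identityʳ w ⟩
      w               ∎
      where
      open ≈[mod]-Reasoning μ
      rearrange : ∀ δ w → δ *ᵍ (w *ᵍ δ) ≡ w *ᵍ (δ *ᵍ δ)
      rearrange = solve-∀ ring

odd⇒%2≡1 : ∀ m → ¬ 2 ℕ.∣ m → m % 2 ≡ 1
odd⇒%2≡1 m 2∤m with m % 2 in m%2≡r | m%n<n m 2
... | 0           | _                    = ⊥-elim (2∤m (ℕ.m%n≡0⇒n∣m m 2 m%2≡r))
... | 1           | _                    = refl
... | suc (suc _) | ℕ.s≤s (ℕ.s≤s ())

odd⇒≈1[mod2] : ∀ m → ¬ 2 ℕ.∣ m → ιℕ m ≈ 1ᵍ [mod ιℕ 2 ]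
odd⇒≈1[mod2] m 2∤m = mod-intro (ιℕ (m / 2)) (begin
  ιℕ m                         ≡⟨ cong ιℕ (m≡m%n+[m/n]*n m 2) ⟩
  ιℕ (m % 2 ℕ.+ m / 2 ℕ.* 2)   ≡⟨ cong (λ r → ιℕ (r ℕ.+ m / 2 ℕ.* 2)) (odd⇒%2≡1 m 2∤m) ⟩
  1ᵍ +ᵍ ιℕ (m / 2 ℕ.* 2)       ≡⟨ cong (1ᵍ +ᵍ_) (ιℕ-* (m / 2) 2) ⟩
  1ᵍ +ᵍ ιℕ (m / 2) *ᵍ ιℕ 2     ∎)
  where open ≡-Reasoning

≈1[mod2]⇒square≈1[mod4] : ∀ {a} → a ≈ 1ᵍ [mod ιℕ 2 ] → a *ᵍ a ≈ 1ᵍ [mod 4ᵍ ]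
≈1[mod2]⇒square≈1[mod4] {a} a≈1 = mod-intro (c +ᵍ c *ᵍ c) (begin
  a *ᵍ a                                    ≡⟨ cong₂ _*ᵍ_ (mod-elim a≈1) (mod-elim a≈1) ⟩
  (1ᵍ +ᵍ c *ᵍ ιℕ 2) *ᵍ (1ᵍ +ᵍ c *ᵍ ιℕ 2)    ≡⟨ square c ⟩
  1ᵍ +ᵍ (c +ᵍ c *ᵍ c) *ᵍ 4ᵍ                 ∎)
  where
  open ≡-Reasoning
  c : 𝔾
  c = quotient a≈1
  square : ∀ c → (1ᵍ +ᵍ c *ᵍ ιℕ 2) *ᵍ (1ᵍ +ᵍ c *ᵍ ιℕ 2) ≡ 1ᵍ +ᵍ (c +ᵍ c *ᵍ c) *ᵍ 4ᵍ
  square = solve-∀ ring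

odd⇒2+2i*m≈2+2i[mod4] : ∀ m → ¬ 2 ℕ.∣ m → 𝔪odd m ≈ 2+2i [mod 4ᵍ ]
odd⇒2+2i*m≈2+2i[mod4] m 2∤m = mod-∣ (1+i , refl) (mod-scale 2+2i (odd⇒≈1[mod2] m 2∤m))

𝔪even≡4*m : ∀ m → 𝔪even m ≡ 4ᵍ *ᵍ ιℕ m
𝔪even≡4*m m = trans (cong ιℕ (sym (ℕ.*-assoc 2 2 m))) (ιℕ-* 4 m)

1+i∣𝔪odd : ∀ m → 1+i ∣ᵍ 𝔪odd m
1+i∣𝔪odd m = ιℕ 2 *ᵍ ιℕ m , identity (ιℕ m)
  where
  identity : ∀ x → 2+2i *ᵍ x ≡ ιℕ 2 *ᵍ x *ᵍ 1+i
  identity = solve-∀ ring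

1+i∣𝔪even : ∀ m → 1+i ∣ᵍ 𝔪even m
1+i∣𝔪even m = ∣ᵍ-trans (gi (+ 2) -[1+ 1 ] , refl) (ιℕ m , trans (𝔪even≡4*m m) (*ᵍ-comm 4ᵍ (ιℕ m)))

≈1[mod𝔪odd]⇒GoodOdd : ∀ m g → g ≈ 1ᵍ [mod 𝔪odd m ] → GoodOdd m g
≈1[mod𝔪odd]⇒GoodOdd m g g≈1 =
  ≡-mod (mod-∣ (ιℕ m , *ᵍ-comm 2+2i (ιℕ m)) g≈1) , + 1 , 1-coprimeTo m , ≡-mod (mod-∣ (2+2i , refl) g≈1)

≈1[mod𝔪even]⇒GoodEven : ∀ m g → g ≈ 1ᵍ [mod 𝔪even m ] → GoodEven m g
≈1[mod𝔪even]⇒GoodEven m g g≈1 =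
  ≡-mod (mod-∣ (ιℕ m , trans (𝔪even≡4*m m) (*ᵍ-comm 4ᵍ (ιℕ m))) g≈1) ,
  + 1 , 1-coprimeTo (2 ℕ.* m) , ≡-mod (mod-∣ (4ᵍ , 𝔪even≡4*m m) g≈1)

-- 4 and m are coprime since m² ≡ 1 mod 4, so δ² ≡ 1 mod 4 and mod m combine.
δ*δ≈1[mod𝔪even] : ∀ m δ → ¬ 2 ℕ.∣ m → δ ≈ 3+2i [mod 4ᵍ ] → δ ≈ 1ᵍ [mod ιℕ m ] → δ *ᵍ δ ≈ 1ᵍ [mod 𝔪even m ]
δ*δ≈1[mod𝔪even] m δ 2∤m δ≈3+2i δ≈1 = subst (δ *ᵍ δ ≈ 1ᵍ [mod_]) (sym (𝔪even≡4*m m))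
  (mod-crt (coprime-sym (ιℕ m) 4ᵍ m-coprime-4) (mod-trans (mod-* δ≈3+2i δ≈3+2i) 3+2i*3+2i≈1[mod4]) (mod-* δ≈1 δ≈1))
  where
  m-coprime-4 : CoprimeTo (ιℕ m) 4ᵍ
  m-coprime-4 = inverse⇒coprime (ιℕ m) (ιℕ m) (≈1[mod2]⇒square≈1[mod4] (odd⇒≈1[mod2] m 2∤m))

J*even-class≈3+2i : ∀ m → ¬ 2 ℕ.∣ m → ∀ αA → CoprimeTo αA (𝔪even m) → αA ≈ 1ᵍ [mod 4ᵍ ] →
  ∃ λ αB → CoprimeTo αB (𝔪even m) × (αB ≡ 3+2i [mod 4ᵍ ]) × (αB ≡ αA [mod ιℕ m ])
         × ¬ SameClass (GoodEven m) ⟨ αB ⟩ ⟨ αA ⟩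
J*even-class≈3+2i m 2∤m αA αA-coprime αA≈1 =
  αA *ᵍ δ₀ , coprime-* αA δ₀ αA-coprime (inverse⇒coprime δ₀ δ₀ (δ*δ≈1[mod𝔪even] m δ₀ 2∤m δ₀≈3+2i δ₀≈1)) ,
  ≡-mod αB≈3+2i , ≡-mod αB≈αA , ≈1∧≈3+2i⇒¬sameClass (GoodEven m) (λ good → ≈-mod (proj₁ good)) αA≈1 αB≈3+2i
  where
  δ₀ : 𝔾
  δ₀ = 1ᵍ +ᵍ 𝔪odd m
  δ₀≈3+2i : δ₀ ≈ 3+2i [mod 4ᵍ ]
  δ₀≈3+2i = mod-+ (mod-refl {a = 1ᵍ}) (odd⇒2+2i*m≈2+2i[mod4] m 2∤m)
  δ₀≈1 : δ₀ ≈ 1ᵍ [mod ιℕ m ]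
  δ₀≈1 = mod-intro 2+2i refl
  αB≈3+2i : αA *ᵍ δ₀ ≈ 3+2i [mod 4ᵍ ]
  αB≈3+2i = mod-* αA≈1 δ₀≈3+2i
  αB≈αA : αA *ᵍ δ₀ ≈ αA [mod ιℕ m ]
  αB≈αA = mod-trans (mod-*ˡ αA δ₀≈1) (mod-reflexive (*ᵍ-identityʳ αA))

lemma2p1 :
    -- (1) n = m odd
    (∀ (m : ℕ) → OddSquareFreePos m →
      ∀ (x : Frac) → InJ* (𝔪odd m) x →
        ∃ λ α → CoprimeTo α (𝔪odd m) × (α ≡ 1ᵍ [mod 4ᵍ ])
          × SameClass (GoodOdd m) x ⟨ α ⟩)
    ×
    -- (2) n = 2m
    (∀ (m : ℕ) → OddSquareFreePos m →
      (∀ (αA : 𝔾) → CoprimeTo αA (𝔪even m) → (αA ≡ 1ᵍ [mod 4ᵍ ]) →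
        ∃ λ αB → CoprimeTo αB (𝔪even m) × (αB ≡ 3+2i [mod 4ᵍ ])
          × (αB ≡ αA [mod ιℕ m ])
          × ¬ SameClass (GoodEven m) ⟨ αB ⟩ ⟨ αA ⟩)
      ×
      (∀ (δ : 𝔾) → (δ ≡ 3+2i [mod 4ᵍ ]) → (δ ≡ 1ᵍ [mod ιℕ m ]) →
        CoprimeTo δ (𝔪even m)
        × (∀ (x : Frac) → InJ* (𝔪even m) x →
            ∃ λ α → CoprimeTo α (𝔪even m) × (α ≡ 1ᵍ [mod 4ᵍ ])
              × (SameClass (GoodEven m) x ⟨ α ⟩
                 ⊎ SameClass (GoodEven m) x ⟨ δ *ᵍ α ⟩))))
lemma2p1 =
  (λ m (_ , 2∤m , _) x x∈J* →
    classRep⇒≈1 (odd⇒2+2i*m≈2+2i[mod4] m 2∤m)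
      (J*-classRep (GoodOdd m) (≈1[mod𝔪odd]⇒GoodOdd m) (1+i∣𝔪odd m) x x∈J*)) ,
  λ m (_ , 2∤m , _) →
    (λ αA αA-coprime αA≡1 → J*even-class≈3+2i m 2∤m αA αA-coprime (≈-mod αA≡1)) ,
    λ δ δ≡3+2i δ≡1 →
      let δδ≈1 = δ*δ≈1[mod𝔪even] m δ 2∤m (≈-mod δ≡3+2i) (≈-mod δ≡1)
      in inverse⇒coprime δ δ δδ≈1 , λ x x∈J* →
           classRep⇒≈1∨δ δ δδ≈1 (≈-mod δ≡3+2i)
             (J*-classRep (GoodEven m) (≈1[mod𝔪even]⇒GoodEven m) (1+i∣𝔪even m) x x∈J*)
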